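{- Let $q\ge1$ be an integer. If $X$ is a set of vertices, then there exist a $q$-uniform hypergraph $H$ and a set $X'\subseteq R:=V(H)\setminus X$ such that all of the following hold: (1) $X\subseteq V(H)$ and $|e\cap X|\le1$ for all $e\in E(H)$; (2) $v(H)=(q+1)\cdot|X|$; (3) $\Delta(H)\le 2q$, and hence $e(H)\le 2(q+1)\cdot|X|$; (4) $|X'|=q-1$ and for every $L\subseteq X$ there exists a matching $M_L$ of $H$ such that $(L\cup R)\setminus X'\subseteq V(M_L)\subseteq L\cup R$. (In particular, if $q$ divides $|L|$, then $M_L$ is a perfect matching of $L\cup R$.)
   Context: A $q$-uniform hypergraph $H$ has vertex set $V(H)$ and edge set $E(H)$ of $q$-subsets; $v(H)=|V(H)|$, $e(H)=|E(H)|$. Here $\Delta(H)$ denotes the maximum number of edges of $H$ containing a single vertex. A matching of $H$ is a set of pairwise disjoint edges, and $V(M)$ denotes the union of the edges of the matching $M$. A perfect matching of a vertex set $U$ is a matching $M$ with $V(M)=U$. -}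

module Defs where

open import Data.Nat using (ℕ; _≤_)
open import Data.Fin using (Fin)
open import Data.Fin.Subset using (Subset; ∣_∣; _∩_; Empty; ⋃)
open import Data.Fin.Subset.Properties using (_∈?_)
open import Data.List using (List; filter; length)
open import Data.List.Relation.Unary.All using (All)
open import Data.List.Relation.Unary.AllPairs using (AllPairs)
open import Data.List.Relation.Unary.Unique.Propositional using (Unique)
open import Data.List.Membership.Propositional renaming (_∈_ to _∈ₗ_)
open import Data.Product using (_×_)
open import Relation.Binary.PropositionalEquality using (_≡_)

record Hypergraph (q : ℕ) : Set where
  field
    nV       : ℕ
    edges    : List (Subset nV)
    uniform  : All (λ e → ∣ e ∣ ≡ q) edges
    distinct : Unique edges

open Hypergraph public

v : ∀ {q} → Hypergraph q → ℕ
v H = nV H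

e : ∀ {q} → Hypergraph q → ℕ
e H = length (edges H)

degree : ∀ {q} (H : Hypergraph q) → Fin (nV H) → ℕ
degree H x = length (filter (x ∈?_) (edges H))

MaxDegree≤ : ∀ {q} → Hypergraph q → ℕ → Set
MaxDegree≤ H k = ∀ x → degree H x ≤ k

IsMatching : ∀ {q} (H : Hypergraph q) → List (Subset (nV H)) → Set
IsMatching H M = All (_∈ₗ edges H) M × AllPairs (λ a b → Empty (a ∩ b)) M

VM : ∀ {n} → List (Subset n) → Subset n
VM M = ⋃ M

{-# OPTIONS --safe #-}
-- X consists of one vertex x from each of n blocks {x, r₁, …, r_q}; the other vertices form R.
-- Blocks are stacked one at a time.  Writing r′ᵢ for the vertices of the block below, the new
-- block brings, for every level c < q, the two edges
--   A_c = {r_{c+1}, …, r_q, r′₁, …, r′_c}   and   B_c = {x, r_{c+2}, …, r_q, r′₁, …, r′_c}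
-- (the first block has nothing below it and only uses level 0).  By induction, for every
-- L ⊆ X some matching covers exactly (L ∪ R) minus the first c vertices r₁, …, r_c of the top
-- block, for some c < q: stacking a block with x ∉ L adds A_c; with x ∈ L it adds B_c and c
-- grows by one, except when c + 1 = q, where B_c = {x, r′₁, …, r′_c} and A₀ = {r₁, …, r_q} are
-- both added and c drops to 0.  Hence X′ = {r₁, …, r_{q−1}} of the top block works.  A vertex
-- r_j lies in j edges A_c, in j − 1 edges B_c and in 2(q − j) edges of the block above, and x
-- lies in q edges, so Δ ≤ 2q.

module Submission where

open import Defs
open import Data.Nat using (ℕ; zero; suc; _≤_; _<_; _+_; _*_; _∸_; z≤n; s≤s; _≤′_; ≤′-refl; ≤′-step)
open import Data.Nat.Properties
open import Data.Nat.Solver using (module +-*-Solver)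
open import Data.Bool using (Bool; true; false; not)
open import Data.Bool.Properties using (∨-identityʳ)
open import Data.Fin using (Fin; _↑ˡ_; _↑ʳ_) renaming (zero to fzero; suc to fsuc)
open import Data.Vec using ([]; _∷_; _++_; lookup; splitAt; here; there)
open import Data.Vec.Properties
  using (lookup-++ˡ; lookup-++ʳ; lookup-map; lookup-replicate; zipWith-++; map-++; map-replicate;
         ++-injectiveˡ; ++-injectiveʳ; ∷-injectiveˡ; ∷-injectiveʳ; []=⇒lookup; lookup⇒[]=)
open import Data.Fin.Subset
  using (Subset; ∣_∣; _∩_; _∪_; _─_; _⊆_; ∁; ⊥; ⊤; ⁅_⁆; _∈_; _∉_; ⋃; Empty)
open import Data.Fin.Subset.Properties
  using (_∈?_; ∉⊥; ⊥⊆; ⊆⊤; ∣⊥∣≡0; ∣⁅x⁆∣≡1; ∣∁p∣≡n∸∣p∣; ∣p∩q∣≤∣q∣; Empty-unique;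
         ⊆-refl; ⊆-reflexive; ⊆-trans; ⊆-antisym; out⊆; s⊆s; p⊆p∪q; q⊆p∪q; p─q⊆p;
         x∈p∩q⁺; x∈p∩q⁻; x∈p∪q⁻; x∈∁p⇒x∉p; x∈p∧x∉q⇒x∈p─q;
         ∩-zeroˡ; ∩-zeroʳ; ∪-identityˡ; ∪-identityʳ; ∪-zeroʳ; p─⊥≡p)
open import Data.List using (List; []; _∷_; map; length; filter) renaming (_++_ to _++ₗ_)
open import Data.List.Properties using (length-++; length-map; map-id)
open import Data.List.Membership.Propositional using () renaming (_∈_ to _∈ₗ_)
import Data.List.Membership.Propositional.Properties as ∈ₗ
open import Data.List.Relation.Binary.Subset.Propositional using () renaming (_⊆_ to _⊆ₗ_)
open import Data.List.Relation.Unary.Any using (here; there)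
open import Data.List.Relation.Unary.All as All using (All; []; _∷_)
import Data.List.Relation.Unary.All.Properties as All
open import Data.List.Relation.Unary.AllPairs as AllPairs using (AllPairs; []; _∷_)
import Data.List.Relation.Unary.AllPairs.Properties as AllPairs
open import Data.List.Relation.Unary.Unique.Propositional using (Unique)
import Data.List.Relation.Unary.Unique.Propositional.Properties as Unique
open import Data.Product using (Σ; _×_; _,_; proj₁; uncurry)
open import Data.Sum using (_⊎_; inj₁; inj₂; [_,_]′)
open import Function using (_∘_)
open import Relation.Nullary using (¬_; yes; no; does)
open import Relation.Binary.PropositionalEquality

private
  variable
    m n : ℕ

data Split (m n : ℕ) : Fin (m + n) → Set where
  left  : (i : Fin m) → Split m n (i ↑ˡ n)
  right : (j : Fin n) → Split m n (m ↑ʳ j)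

split : ∀ m n (x : Fin (m + n)) → Split m n x
split zero    n x        = right x
split (suc m) n fzero    = left fzero
split (suc m) n (fsuc x) with split m n x
... | left i  = left (fsuc i)
... | right j = right j

∈-++⁺ˡ : {p : Subset m} (q : Subset n) {i : Fin m} → i ∈ p → i ↑ˡ n ∈ p ++ q
∈-++⁺ˡ {p = p} q {i} i∈p = lookup⇒[]= _ (p ++ q) (trans (lookup-++ˡ p q i) ([]=⇒lookup i∈p))

∈-++⁺ʳ : (p : Subset m) {q : Subset n} {j : Fin n} → j ∈ q → m ↑ʳ j ∈ p ++ q
∈-++⁺ʳ p {q} {j} j∈q = lookup⇒[]= _ (p ++ q) (trans (lookup-++ʳ p q j) ([]=⇒lookup j∈q))

∈-++⁻ˡ : (p : Subset m) {q : Subset n} {i : Fin m} → i ↑ˡ n ∈ p ++ q → i ∈ p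
∈-++⁻ˡ p {q} {i} i∈ = lookup⇒[]= i p (trans (sym (lookup-++ˡ p q i)) ([]=⇒lookup i∈))

∈-++⁻ʳ : (p : Subset m) {q : Subset n} {j : Fin n} → m ↑ʳ j ∈ p ++ q → j ∈ q
∈-++⁻ʳ p {q} {j} j∈ = lookup⇒[]= j q (trans (sym (lookup-++ʳ p q j)) ([]=⇒lookup j∈))

++-mono-⊆ : {p p′ : Subset m} {q q′ : Subset n} → p ⊆ p′ → q ⊆ q′ → p ++ q ⊆ p′ ++ q′
++-mono-⊆ {m} {n} {p} {p′} p⊆p′ q⊆q′ {x} x∈ with split m n x
... | left i  = ∈-++⁺ˡ _ (p⊆p′ (∈-++⁻ˡ p x∈))
... | right j = ∈-++⁺ʳ p′ (q⊆q′ (∈-++⁻ʳ p x∈))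

⊆-++⁻ʳ : (p p′ : Subset m) {q q′ : Subset n} → p ++ q ⊆ p′ ++ q′ → q ⊆ q′
⊆-++⁻ʳ p p′ pq⊆ j∈q = ∈-++⁻ʳ p′ (pq⊆ (∈-++⁺ʳ p j∈q))

Empty-++ : {p : Subset m} {q : Subset n} → Empty p → Empty q → Empty (p ++ q)
Empty-++ {m} {n} {p} ∅p ∅q (x , x∈) with split m n x
... | left i  = ∅p (i , ∈-++⁻ˡ p x∈)
... | right j = ∅q (j , ∈-++⁻ʳ p x∈)

∩-++ : (p p′ : Subset m) (q q′ : Subset n) → (p ++ q) ∩ (p′ ++ q′) ≡ (p ∩ p′) ++ (q ∩ q′)
∩-++ p p′ q q′ = zipWith-++ _ p q p′ q′

∪-++ : (p p′ : Subset m) (q q′ : Subset n) → (p ++ q) ∪ (p′ ++ q′) ≡ (p ∪ p′) ++ (q ∪ q′)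
∪-++ p p′ q q′ = zipWith-++ _ p q p′ q′

─-++ : (p p′ : Subset m) (q q′ : Subset n) → (p ++ q) ─ (p′ ++ q′) ≡ (p ─ p′) ++ (q ─ q′)
─-++ p p′ q q′ = zipWith-++ _ p q p′ q′

∁-++ : (p : Subset m) (q : Subset n) → ∁ (p ++ q) ≡ ∁ p ++ ∁ q
∁-++ = map-++ not

⊥-++ : ⊥ {m} ++ ⊥ {n} ≡ ⊥
⊥-++ {zero}  = refl
⊥-++ {suc m} = cong (false ∷_) (⊥-++ {m})

∣-++∣ : (p : Subset m) (q : Subset n) → ∣ p ++ q ∣ ≡ ∣ p ∣ + ∣ q ∣
∣-++∣ []          q = refl
∣-++∣ (true ∷ p)  q = cong suc (∣-++∣ p q)
∣-++∣ (false ∷ p) q = ∣-++∣ p q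

∣⊥-++∣ : (p : Subset n) → ∣ ⊥ {m} ++ p ∣ ≡ ∣ p ∣
∣⊥-++∣ {m = m} p = trans (∣-++∣ (⊥ {m}) p) (cong (_+ ∣ p ∣) (∣⊥∣≡0 m))

∣∩-++∣ : (p p′ : Subset m) (q q′ : Subset n) →
         ∣ (p ++ q) ∩ (p′ ++ q′) ∣ ≡ ∣ p ∩ p′ ∣ + ∣ q ∩ q′ ∣
∣∩-++∣ p p′ q q′ = trans (cong ∣_∣ (∩-++ p p′ q q′)) (∣-++∣ (p ∩ p′) (q ∩ q′))

⋃-map-⊥-++ : (M : List (Subset n)) → ⋃ (map (⊥ {m} ++_) M) ≡ ⊥ ++ ⋃ M
⋃-map-⊥-++ {m = m} []      = sym (⊥-++ {m})
⋃-map-⊥-++ {m = m} (e ∷ M) = begin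
  (⊥ ++ e) ∪ ⋃ (map (⊥ ++_) M) ≡⟨ cong ((⊥ ++ e) ∪_) (⋃-map-⊥-++ M) ⟩
  (⊥ ++ e) ∪ (⊥ ++ ⋃ M)        ≡⟨ ∪-++ ⊥ ⊥ e (⋃ M) ⟩
  (⊥ ∪ ⊥) ++ (e ∪ ⋃ M)         ≡⟨ cong (_++ (e ∪ ⋃ M)) (∪-identityˡ (⊥ {m})) ⟩
  ⊥ ++ (e ∪ ⋃ M)               ∎
  where open ≡-Reasoning

Empty-⊥ : Empty (⊥ {n})
Empty-⊥ (_ , x∈⊥) = ∉⊥ x∈⊥

≡⊥⇒Empty : {p : Subset n} → p ≡ ⊥ → Empty p
≡⊥⇒Empty refl = Empty-⊥

∁⊥≡⊤ : ∁ (⊥ {n}) ≡ ⊤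
∁⊥≡⊤ = map-replicate not false _

∁⊤≡⊥ : ∁ (⊤ {n}) ≡ ⊥
∁⊤≡⊥ = map-replicate not true _

⊤─p≡∁p : (p : Subset n) → ⊤ ─ p ≡ ∁ p
⊤─p≡∁p []          = refl
⊤─p≡∁p (true ∷ p)  = cong (false ∷_) (⊤─p≡∁p p)
⊤─p≡∁p (false ∷ p) = cong (true ∷_) (⊤─p≡∁p p)

x∈p─q⇒x∉q : (p q : Subset n) {x : Fin n} → x ∈ p ─ q → x ∉ q
x∈p─q⇒x∉q (true ∷ p) (false ∷ q) here       ()
x∈p─q⇒x∉q (_ ∷ p)    (_ ∷ q)     (there x∈) (there x∈q) = x∈p─q⇒x∉q p q x∈ x∈q

─-antimonoʳ-⊆ : (p : Subset n) {q q′ : Subset n} → q ⊆ q′ → p ─ q′ ⊆ p ─ q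
─-antimonoʳ-⊆ p {q′ = q′} q⊆q′ x∈ =
  x∈p∧x∉q⇒x∈p─q (p─q⊆p p q′ x∈) (x∈p─q⇒x∉q p q′ x∈ ∘ q⊆q′)

p∪[q─p]≡q : {p q : Subset n} → p ⊆ q → p ∪ (q ─ p) ≡ q
p∪[q─p]≡q {p = p} {q} p⊆q = ⊆-antisym ⊆q q⊆
  where
  ⊆q : p ∪ (q ─ p) ⊆ q
  ⊆q x∈ = [ p⊆q , p─q⊆p q p ]′ (x∈p∪q⁻ p (q ─ p) x∈)
  q⊆ : q ⊆ p ∪ (q ─ p)
  q⊆ {x} x∈q with x ∈? p
  ... | yes x∈p = p⊆p∪q (q ─ p) x∈p
  ... | no  x∉p = q⊆p∪q p (q ─ p) (x∈p∧x∉q⇒x∈p─q x∈q x∉p)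

Empty[p∩[q─p]] : (p q : Subset n) → Empty (p ∩ (q ─ p))
Empty[p∩[q─p]] p q (x , x∈) with x∈p∩q⁻ p (q ─ p) x∈
... | x∈p , x∈q─p = x∈p─q⇒x∉q q p x∈q─p x∈p

p⊆∁q⇒∣p∩q∣≡0 : {p q : Subset n} → p ⊆ ∁ q → ∣ p ∩ q ∣ ≡ 0
p⊆∁q⇒∣p∩q∣≡0 {n} {p} {q} p⊆∁q = trans (cong ∣_∣ (Empty-unique disjoint)) (∣⊥∣≡0 n)
  where
  disjoint : Empty (p ∩ q)
  disjoint (x , x∈) with x∈p∩q⁻ p q x∈
  ... | x∈p , x∈q = x∈∁p⇒x∉p (p⊆∁q x∈p) x∈q

prefix : ℕ → (n : ℕ) → Subset n
prefix zero    n       = ⊥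
prefix (suc c) zero    = []
prefix (suc c) (suc n) = true ∷ prefix c n

∣prefix∣ : ∀ {c n} → c ≤ n → ∣ prefix c n ∣ ≡ c
∣prefix∣ {zero}  {n}     _         = ∣⊥∣≡0 n
∣prefix∣ {suc c} {suc n} (s≤s c≤n) = cong suc (∣prefix∣ c≤n)

prefix-mono : ∀ n {c c′} → c ≤ c′ → prefix c n ⊆ prefix c′ n
prefix-mono n       {zero}  {c′}    _         = ⊥⊆ {p = prefix c′ n}
prefix-mono zero    {suc c} {suc c′} _        = λ ()
prefix-mono (suc n) {suc c} {suc c′} (s≤s c≤c′) = s⊆s (prefix-mono n c≤c′)

prefix-full : ∀ n → prefix n n ≡ ⊤
prefix-full zero    = refl
prefix-full (suc n) = cong (true ∷_) (prefix-full n)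

∣∁prefix∣+c≡n : ∀ {c n} → c ≤ n → ∣ ∁ (prefix c n) ∣ + c ≡ n
∣∁prefix∣+c≡n {c} {n} c≤n = begin
  ∣ ∁ (prefix c n) ∣ + c   ≡⟨ cong (_+ c) (∣∁p∣≡n∸∣p∣ (prefix c n)) ⟩
  (n ∸ ∣ prefix c n ∣) + c ≡⟨ cong (λ s → (n ∸ s) + c) (∣prefix∣ c≤n) ⟩
  (n ∸ c) + c              ≡⟨ m∸n+n≡m c≤n ⟩
  n                        ∎
  where open ≡-Reasoning

∁prefix-injective : ∀ {c c′ n} → c ≤ n → c′ ≤ n → ∁ (prefix c n) ≡ ∁ (prefix c′ n) → c ≡ c′
∁prefix-injective {c} {c′} {n} c≤n c′≤n eq = +-cancelˡ-≡ ∣ ∁ (prefix c n) ∣ c c′ (begin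
  ∣ ∁ (prefix c n) ∣ + c   ≡⟨ ∣∁prefix∣+c≡n c≤n ⟩
  n                        ≡⟨ sym (∣∁prefix∣+c≡n c′≤n) ⟩
  ∣ ∁ (prefix c′ n) ∣ + c′ ≡⟨ cong (λ p → ∣ p ∣ + c′) (sym eq) ⟩
  ∣ ∁ (prefix c n) ∣ + c′  ∎)
  where open ≡-Reasoning

∁prefix≢⊥ : ∀ {c n} → c < n → ∁ (prefix c n) ≢ ⊥
∁prefix≢⊥ {c} {n} c<n eq = <-irrefl c≡n c<n
  where
  c≡n : c ≡ n
  c≡n = trans (cong (_+ c) (sym (∣⊥∣≡0 n)))
              (trans (cong (λ p → ∣ p ∣ + c) (sym eq)) (∣∁prefix∣+c≡n (<⇒≤ c<n)))

IsMatchingIn : List (Subset n) → List (Subset n) → Set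
IsMatchingIn es M = All (_∈ₗ es) M × AllPairs (λ a b → Empty (a ∩ b)) M

PerfectMatching : List (Subset n) → Subset n → Set
PerfectMatching {n} es W = Σ (List (Subset n)) λ M → IsMatchingIn es M × ⋃ M ≡ W

⊆-⋃ : (M : List (Subset n)) {e : Subset n} → e ∈ₗ M → e ⊆ ⋃ M
⊆-⋃ (e ∷ M)  (here refl) = p⊆p∪q (⋃ M)
⊆-⋃ (e′ ∷ M) (there e∈M) = q⊆p∪q e′ (⋃ M) ∘ ⊆-⋃ M e∈M

perfectMatching-⊆ : {es es′ : List (Subset n)} {W : Subset n} → es ⊆ₗ es′ →
                    PerfectMatching es W → PerfectMatching es′ W
perfectMatching-⊆ es⊆es′ (M , (M⊆es , apart) , ⋃M≡W) =
  M , (All.map es⊆es′ M⊆es , apart) , ⋃M≡W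

perfectMatching-∷ : {es : List (Subset n)} {e W : Subset n} → e ∈ₗ es → Empty (e ∩ W) →
                    PerfectMatching es W → PerfectMatching es (e ∪ W)
perfectMatching-∷ {e = e} e∈es ∅ (M , (M⊆es , apart) , refl) =
  e ∷ M , (e∈es ∷ M⊆es , All.tabulate e-apart ∷ apart) , refl
  where
  e-apart : ∀ {b} → b ∈ₗ M → Empty (e ∩ b)
  e-apart {b} b∈M (x , x∈) with x∈p∩q⁻ e b x∈
  ... | x∈e , x∈b = ∅ (x , x∈p∩q⁺ (x∈e , ⊆-⋃ M b∈M x∈b))

perfectMatching-lift : {es : List (Subset n)} {W : Subset n} →
                       PerfectMatching es W → PerfectMatching (map (⊥ {m} ++_) es) (⊥ ++ W)
perfectMatching-lift {m = m} (M , (M⊆es , apart) , ⋃M≡W) =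
  map (⊥ ++_) M ,
  (All.map⁺ (All.map (∈ₗ.∈-map⁺ (⊥ ++_)) M⊆es) , AllPairs.map⁺ (AllPairs.map lift-apart apart)) ,
  trans (⋃-map-⊥-++ M) (cong (⊥ ++_) ⋃M≡W)
  where
  lift-apart : ∀ {a b} → Empty (a ∩ b) → Empty ((⊥ {m} ++ a) ∩ (⊥ ++ b))
  lift-apart {a} {b} ∅ = subst Empty (sym (∩-++ ⊥ ⊥ a b)) (Empty-++ (≡⊥⇒Empty (∩-zeroˡ ⊥)) ∅)

indicator : Bool → ℕ
indicator true  = 1
indicator false = 0

degreeIn : Fin n → List (Subset n) → ℕ
degreeIn x []       = 0
degreeIn x (e ∷ es) = indicator (lookup e x) + degreeIn x es

does-∈? : (x : Fin n) (p : Subset n) → does (x ∈? p) ≡ lookup p x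
does-∈? fzero    (true ∷ p)  = refl
does-∈? fzero    (false ∷ p) = refl
does-∈? (fsuc x) (_ ∷ p)     = does-∈? x p

length-filter-∈?≡degreeIn : (x : Fin n) (es : List (Subset n)) →
                            length (filter (x ∈?_) es) ≡ degreeIn x es
length-filter-∈?≡degreeIn x []       = refl
length-filter-∈?≡degreeIn x (e ∷ es) with does (x ∈? e) | does-∈? x e
... | true  | eq rewrite sym eq = cong suc (length-filter-∈?≡degreeIn x es)
... | false | eq rewrite sym eq = length-filter-∈?≡degreeIn x es

degreeIn-++ : (x : Fin n) (es fs : List (Subset n)) →
              degreeIn x (es ++ₗ fs) ≡ degreeIn x es + degreeIn x fs
degreeIn-++ x []       fs = refl
degreeIn-++ x (e ∷ es) fs =
  trans (cong (indicator (lookup e x) +_) (degreeIn-++ x es fs))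
        (sym (+-assoc (indicator (lookup e x)) _ _))

module _ {A : Set} (f : A → Subset m) (h : A → Subset n) where

  degreeIn-map-++ˡ : (xs : List A) (i : Fin m) →
                     degreeIn (i ↑ˡ n) (map (λ a → f a ++ h a) xs) ≡ degreeIn i (map f xs)
  degreeIn-map-++ˡ []       i = refl
  degreeIn-map-++ˡ (a ∷ xs) i rewrite lookup-++ˡ (f a) (h a) i = cong (_ +_) (degreeIn-map-++ˡ xs i)

  degreeIn-map-++ʳ : (xs : List A) (j : Fin n) →
                     degreeIn (m ↑ʳ j) (map (λ a → f a ++ h a) xs) ≡ degreeIn j (map h xs)
  degreeIn-map-++ʳ []       j = refl
  degreeIn-map-++ʳ (a ∷ xs) j rewrite lookup-++ʳ (f a) (h a) j = cong (_ +_) (degreeIn-map-++ʳ xs j)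

degreeIn-map-⊥ : {A : Set} (xs : List A) (x : Fin n) → degreeIn x (map (λ _ → ⊥) xs) ≡ 0
degreeIn-map-⊥ []       x = refl
degreeIn-map-⊥ (a ∷ xs) x rewrite lookup-replicate x false = degreeIn-map-⊥ xs x

levels : ℕ → List (ℕ × Bool)
levels zero    = []
levels (suc c) = (c , false) ∷ (c , true) ∷ levels c

length-levels : ∀ g → length (levels g) ≡ 2 * g
length-levels zero    = refl
length-levels (suc g) = trans (cong (suc ∘ suc) (length-levels g)) (sym (*-suc 2 g))

∈-levels⁺ : ∀ {c g} b → c < g → (c , b) ∈ₗ levels g
∈-levels⁺ b     (s≤s c≤g) with m≤n⇒m<n∨m≡n c≤g
∈-levels⁺ b     _ | inj₁ c<g  = there (there (∈-levels⁺ b c<g))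
∈-levels⁺ false _ | inj₂ refl = here refl
∈-levels⁺ true  _ | inj₂ refl = there (here refl)

∈-levels⁻ : ∀ {g x} → x ∈ₗ levels g → proj₁ x < g
∈-levels⁻ {suc g} (here refl)         = ≤-refl
∈-levels⁻ {suc g} (there (here refl)) = ≤-refl
∈-levels⁻ {suc g} (there (there x∈))  = m<n⇒m<1+n (∈-levels⁻ x∈)

Unique-map-levels : {A : Set} (f : ℕ × Bool → A) (g : ℕ) →
                    (∀ {x y} → proj₁ x < g → proj₁ y < g → f x ≡ f y → x ≡ y) →
                    Unique (map f (levels g))
Unique-map-levels f zero    f-inj = []
Unique-map-levels f (suc g) f-inj =
  (false≢true ∷ All.map⁺ (All.tabulate (fresh false))) ∷ All.map⁺ (All.tabulate (fresh true)) ∷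
  Unique-map-levels f g (λ x<g y<g → f-inj (m<n⇒m<1+n x<g) (m<n⇒m<1+n y<g))
  where
  false≢true : f (g , false) ≢ f (g , true)
  false≢true eq with f-inj ≤-refl ≤-refl eq
  ... | ()
  fresh : ∀ b {x} → x ∈ₗ levels g → f (g , b) ≢ f x
  fresh b x∈ eq =
    <-irrefl (sym (cong proj₁ (f-inj ≤-refl (m<n⇒m<1+n (∈-levels⁻ x∈)) eq))) (∈-levels⁻ x∈)

degreeIn-map-levels-mono : (f : ℕ × Bool → Subset n) (x : Fin n) {g g′ : ℕ} → g ≤ g′ →
                           degreeIn x (map f (levels g)) ≤ degreeIn x (map f (levels g′))
degreeIn-map-levels-mono f x g≤g′ = go (≤⇒≤′ g≤g′)
  where
  go : ∀ {g g′} → g ≤′ g′ → degreeIn x (map f (levels g)) ≤ degreeIn x (map f (levels g′))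
  go ≤′-refl                  = ≤-refl
  go (≤′-step {n = g′} g≤′g′) =
    ≤-trans (go g≤′g′) (≤-trans (m≤n+m _ (indicator (lookup (f (g′ , true)) x)))
                                (m≤n+m _ (indicator (lookup (f (g′ , false)) x))))

module Construction (q : ℕ) (0<q : 0 < q) where

  -- In a block, fzero is x and fsuc j is r_{j+1}.  tip c false and tip c true are the parts
  -- of A_c and B_c inside the new block, and spare c = {r₁, …, r_c}.
  tip : ℕ → Bool → Subset (suc q)
  tip c false = false ∷ ∁ (prefix c q)
  tip c true  = true ∷ ∁ (prefix (suc c) q)

  spare : ℕ → Subset (suc q)
  spare c = false ∷ prefix c q

  ∣tip∣+c≡q : ∀ {c} b → c < q → ∣ tip c b ∣ + c ≡ q
  ∣tip∣+c≡q false c<q = ∣∁prefix∣+c≡n (<⇒≤ c<q)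
  ∣tip∣+c≡q {c} true c<q = trans (sym (+-suc ∣ ∁ (prefix (suc c) q) ∣ c)) (∣∁prefix∣+c≡n c<q)

  tip-injective : ∀ {c c′ b b′} → c < q → c′ < q → tip c b ≡ tip c′ b′ → (c , b) ≡ (c′ , b′)
  tip-injective {b = false} {false} c<q c′<q eq =
    cong (_, false) (∁prefix-injective (<⇒≤ c<q) (<⇒≤ c′<q) (∷-injectiveʳ eq))
  tip-injective {b = true}  {true}  c<q c′<q eq =
    cong (_, true) (suc-injective (∁prefix-injective c<q c′<q (∷-injectiveʳ eq)))
  tip-injective {b = false} {true}  _ _ eq with ∷-injectiveˡ eq
  ... | ()
  tip-injective {b = true}  {false} _ _ eq with ∷-injectiveˡ eq
  ... | ()

  tip≢⊥ : ∀ {c} b → c < q → tip c b ≢ ⊥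
  tip≢⊥ false c<q eq = ∁prefix≢⊥ c<q (∷-injectiveʳ eq)
  tip≢⊥ true  _   eq with ∷-injectiveˡ eq
  ... | ()

  tip-last : ∀ {c} → suc c ≡ q → tip c true ≡ ⁅ fzero ⁆
  tip-last refl = cong (true ∷_) (trans (cong ∁ (prefix-full q)) ∁⊤≡⊥)

  levelEdge : (ℕ → Subset m) → ℕ × Bool → Subset (suc q + m)
  levelEdge Y (c , b) = tip c b ++ Y c

  layer : (ℕ → Subset m) → ℕ → List (Subset m) → List (Subset (suc q + m))
  layer Y g es = map (levelEdge Y) (levels g) ++ₗ map (⊥ ++_) es

  module _ (Y : ℕ → Subset m) (g : ℕ) (es : List (Subset m)) where

    length-layer : length (layer Y g es) ≡ 2 * g + length es
    length-layer = begin
      length (layer Y g es)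
        ≡⟨ length-++ (map (levelEdge Y) (levels g)) ⟩
      length (map (levelEdge Y) (levels g)) + length (map (⊥ ++_) es)
        ≡⟨ cong₂ _+_ (length-map _ (levels g)) (length-map _ es) ⟩
      length (levels g) + length es
        ≡⟨ cong (_+ length es) (length-levels g) ⟩
      2 * g + length es ∎
      where open ≡-Reasoning

    degreeIn-layer-new : ∀ y → degreeIn (y ↑ˡ m) (layer Y g es) ≡
                               degreeIn y (map (uncurry tip) (levels g))
    degreeIn-layer-new y = begin
      degreeIn (y ↑ˡ m) (layer Y g es)
        ≡⟨ degreeIn-++ (y ↑ˡ m) (map (levelEdge Y) (levels g)) _ ⟩
      degreeIn (y ↑ˡ m) (map (levelEdge Y) (levels g)) + degreeIn (y ↑ˡ m) (map (⊥ ++_) es)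
        ≡⟨ cong₂ _+_ (degreeIn-map-++ˡ (uncurry tip) (Y ∘ proj₁) (levels g) y)
                     (degreeIn-map-++ˡ (λ _ → ⊥) (λ e → e) es y) ⟩
      degreeIn y (map (uncurry tip) (levels g)) + degreeIn y (map (λ _ → ⊥) es)
        ≡⟨ cong (_ +_) (degreeIn-map-⊥ es y) ⟩
      degreeIn y (map (uncurry tip) (levels g)) + 0
        ≡⟨ +-identityʳ _ ⟩
      degreeIn y (map (uncurry tip) (levels g)) ∎
      where open ≡-Reasoning

    degreeIn-layer-old : ∀ z → degreeIn (suc q ↑ʳ z) (layer Y g es) ≡
                               degreeIn z (map (Y ∘ proj₁) (levels g)) + degreeIn z es
    degreeIn-layer-old z = begin
      degreeIn (suc q ↑ʳ z) (layer Y g es)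
        ≡⟨ degreeIn-++ (suc q ↑ʳ z) (map (levelEdge Y) (levels g)) _ ⟩
      degreeIn (suc q ↑ʳ z) (map (levelEdge Y) (levels g)) + degreeIn (suc q ↑ʳ z) (map (⊥ ++_) es)
        ≡⟨ cong₂ _+_ (degreeIn-map-++ʳ (uncurry tip) (Y ∘ proj₁) (levels g) z)
                     (degreeIn-map-++ʳ (λ _ → ⊥) (λ e → e) es z) ⟩
      degreeIn z (map (Y ∘ proj₁) (levels g)) + degreeIn z (map (λ e → e) es)
        ≡⟨ cong (λ fs → _ + degreeIn z fs) (map-id es) ⟩
      degreeIn z (map (Y ∘ proj₁) (levels g)) + degreeIn z es ∎
      where open ≡-Reasoning

  module _ {Y : ℕ → Subset m} {g : ℕ} {es : List (Subset m)} where

    layer-uniform : g ≤ q → (∀ {c} → c < g → ∣ Y c ∣ ≡ c) →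
                    All (λ e → ∣ e ∣ ≡ q) es → All (λ e → ∣ e ∣ ≡ q) (layer Y g es)
    layer-uniform g≤q ∣Y∣ es-uniform =
      All.++⁺ (All.map⁺ (All.tabulate level-uniform))
              (All.map⁺ (All.map (trans (∣⊥-++∣ {m = suc q} _)) es-uniform))
      where
      level-uniform : ∀ {x} → x ∈ₗ levels g → ∣ levelEdge Y x ∣ ≡ q
      level-uniform {c , b} x∈ = begin
        ∣ tip c b ++ Y c ∣      ≡⟨ ∣-++∣ (tip c b) (Y c) ⟩
        ∣ tip c b ∣ + ∣ Y c ∣   ≡⟨ cong (∣ tip c b ∣ +_) (∣Y∣ (∈-levels⁻ x∈)) ⟩
        ∣ tip c b ∣ + c         ≡⟨ ∣tip∣+c≡q b (≤-trans (∈-levels⁻ x∈) g≤q) ⟩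
        q                       ∎
        where open ≡-Reasoning

    layer-unique : g ≤ q → Unique es → Unique (layer Y g es)
    layer-unique g≤q es-unique =
      Unique.++⁺ (Unique-map-levels (levelEdge Y) g levelEdge-injective)
                 (Unique.map⁺ (++-injectiveʳ ⊥ ⊥) es-unique) apart
      where
      levelEdge-injective : ∀ {x y} → proj₁ x < g → proj₁ y < g → levelEdge Y x ≡ levelEdge Y y → x ≡ y
      levelEdge-injective {c , b} {c′ , b′} c<g c′<g eq =
        tip-injective (≤-trans c<g g≤q) (≤-trans c′<g g≤q) (++-injectiveˡ (tip c b) (tip c′ b′) eq)
      apart : ∀ {e} → ¬ (e ∈ₗ map (levelEdge Y) (levels g) × e ∈ₗ map (⊥ ++_) es)
      apart (e∈levels , e∈lifted)
        with ∈ₗ.∈-map⁻ (levelEdge Y) e∈levels | ∈ₗ.∈-map⁻ (⊥ ++_) e∈lifted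
      ... | (c , b) , x∈ , refl | _ , _ , eq =
        tip≢⊥ b (≤-trans (∈-levels⁻ x∈) g≤q) (++-injectiveˡ (tip c b) ⊥ eq)

    layer-meets-≤1 : (X : Subset m) → (∀ c → Y c ⊆ ∁ X) → All (λ e → ∣ e ∩ X ∣ ≤ 1) es →
                     All (λ e → ∣ e ∩ (⁅ fzero ⁆ ++ X) ∣ ≤ 1) (layer Y g es)
    layer-meets-≤1 X Y⊆∁X es-meet =
      All.++⁺ (All.map⁺ (All.universal level-meets (levels g)))
              (All.map⁺ (All.map lifted-meets es-meet))
      where
      level-meets : ∀ x → ∣ levelEdge Y x ∩ (⁅ fzero ⁆ ++ X) ∣ ≤ 1
      level-meets (c , b) = begin
        ∣ (tip c b ++ Y c) ∩ (⁅ fzero ⁆ ++ X) ∣ ≡⟨ ∣∩-++∣ (tip c b) ⁅ fzero ⁆ (Y c) X ⟩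
        ∣ tip c b ∩ ⁅ fzero ⁆ ∣ + ∣ Y c ∩ X ∣  ≡⟨ cong (_ +_) (p⊆∁q⇒∣p∩q∣≡0 (Y⊆∁X c)) ⟩
        ∣ tip c b ∩ ⁅ fzero ⁆ ∣ + 0             ≡⟨ +-identityʳ _ ⟩
        ∣ tip c b ∩ ⁅ fzero ⁆ ∣                 ≤⟨ ∣p∩q∣≤∣q∣ (tip c b) ⁅ fzero ⁆ ⟩
        ∣ ⁅ fzero {q} ⁆ ∣                       ≡⟨ ∣⁅x⁆∣≡1 (fzero {q}) ⟩
        1                                       ∎
        where open ≤-Reasoning
      lifted-meets : ∀ {e} → ∣ e ∩ X ∣ ≤ 1 → ∣ (⊥ {suc q} ++ e) ∩ (⁅ fzero ⁆ ++ X) ∣ ≤ 1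
      lifted-meets {e} = subst (_≤ 1) (sym (begin
        ∣ (⊥ {suc q} ++ e) ∩ (⁅ fzero ⁆ ++ X) ∣ ≡⟨ ∣∩-++∣ (⊥ {suc q}) ⁅ fzero ⁆ e X ⟩
        ∣ ⊥ ∩ ⁅ fzero {q} ⁆ ∣ + ∣ e ∩ X ∣       ≡⟨ cong (λ p → ∣ p ∣ + ∣ e ∩ X ∣) (∩-zeroˡ ⁅ fzero {q} ⁆) ⟩
        ∣ ⊥ {suc q} ∣ + ∣ e ∩ X ∣               ≡⟨ cong (_+ ∣ e ∩ X ∣) (∣⊥∣≡0 (suc q)) ⟩
        ∣ e ∩ X ∣                               ∎))
        where open ≡-Reasoning

    layer-extend : ∀ {W c} b → c < g → Y c ⊆ W →
                   PerfectMatching es (W ─ Y c) → PerfectMatching (layer Y g es) (tip c b ++ W)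
    layer-extend {W} {c} b c<g Yc⊆W pm =
      subst (PerfectMatching (layer Y g es)) union
        (perfectMatching-∷ edge∈ apart
          (perfectMatching-⊆ (∈ₗ.∈-++⁺ʳ (map (levelEdge Y) (levels g))) (perfectMatching-lift pm)))
      where
      edge∈ : levelEdge Y (c , b) ∈ₗ layer Y g es
      edge∈ = ∈ₗ.∈-++⁺ˡ (∈ₗ.∈-map⁺ (levelEdge Y) (∈-levels⁺ b c<g))
      apart : Empty ((tip c b ++ Y c) ∩ (⊥ ++ (W ─ Y c)))
      apart = subst Empty (sym (∩-++ (tip c b) ⊥ (Y c) (W ─ Y c)))
                (Empty-++ (≡⊥⇒Empty (∩-zeroʳ (tip c b))) (Empty[p∩[q─p]] (Y c) W))
      union : (tip c b ++ Y c) ∪ (⊥ ++ (W ─ Y c)) ≡ tip c b ++ W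
      union = trans (∪-++ (tip c b) ⊥ (Y c) (W ─ Y c))
                    (cong₂ _++_ (∪-identityʳ (tip c b)) (p∪[q─p]≡q Yc⊆W))

    layer-restart : ∀ {W} → Y 0 ≡ ⊥ → 0 < g →
                    PerfectMatching (layer Y g es) (⁅ fzero ⁆ ++ W) →
                    PerfectMatching (layer Y g es) ((true ∷ ∁ ⊥) ++ W)
    layer-restart {W} Y0≡⊥ 0<g pm =
      subst (PerfectMatching (layer Y g es)) union (perfectMatching-∷ edge∈ apart pm)
      where
      edge∈ : levelEdge Y (0 , false) ∈ₗ layer Y g es
      edge∈ = ∈ₗ.∈-++⁺ˡ (∈ₗ.∈-map⁺ (levelEdge Y) (∈-levels⁺ false 0<g))
      apart : Empty ((tip 0 false ++ Y 0) ∩ (⁅ fzero ⁆ ++ W))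
      apart = subst Empty (sym (∩-++ (tip 0 false) ⁅ fzero ⁆ (Y 0) W))
                (Empty-++ (≡⊥⇒Empty (cong (false ∷_) (∩-zeroʳ (∁ ⊥))))
                          (≡⊥⇒Empty (trans (cong (_∩ W) Y0≡⊥) (∩-zeroˡ W))))
      union : (tip 0 false ++ Y 0) ∪ (⁅ fzero ⁆ ++ W) ≡ (true ∷ ∁ ⊥) ++ W
      union = trans (∪-++ (tip 0 false) ⁅ fzero ⁆ (Y 0) W)
                    (cong₂ _++_ (cong (true ∷_) (∪-identityʳ (∁ ⊥)))
                                (trans (cong (_∪ W) Y0≡⊥) (∪-identityˡ W)))

    layer-step : ∀ {W c} → Y 0 ≡ ⊥ → g ≤ q → c < g → Y c ⊆ W →
                 PerfectMatching es (W ─ Y c) → (l : Bool) →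
                 Σ ℕ λ c′ → c′ < q × PerfectMatching (layer Y g es) ((l ∷ ∁ (prefix c′ q)) ++ W)
    layer-step {c = c} Y0≡⊥ g≤q c<g Yc⊆W pm false =
      c , ≤-trans c<g g≤q , layer-extend false c<g Yc⊆W pm
    layer-step {W} {c} Y0≡⊥ g≤q c<g Yc⊆W pm true with m≤n⇒m<n∨m≡n (≤-trans c<g g≤q)
    ... | inj₁ 1+c<q = suc c , 1+c<q , layer-extend true c<g Yc⊆W pm
    ... | inj₂ 1+c≡q = 0 , 0<q , layer-restart Y0≡⊥ (≤-trans (s≤s z≤n) c<g)
      (subst (λ t → PerfectMatching (layer Y g es) (t ++ W)) (tip-last 1+c≡q) (layer-extend true c<g Yc⊆W pm))

  level-degree≤2 : ∀ c (y : Fin (suc q)) →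
    indicator (lookup (tip c false) y) + indicator (lookup (tip c true) y)
      + (indicator (lookup (spare c) y) + indicator (lookup (spare c) y)) ≤ 2
  level-degree≤2 c fzero    = s≤s z≤n
  -- A vertex of spare c also lies in spare (suc c), hence in neither tip.
  level-degree≤2 c (fsuc j) rewrite lookup-map j not (prefix c q) | lookup-map j not (prefix (suc c) q) =
    bound (lookup (prefix c q) j) (lookup (prefix (suc c) q) j)
          (λ eq → []=⇒lookup (prefix-mono q (n≤1+n c) (lookup⇒[]= j (prefix c q) eq)))
    where
    bound : ∀ s s′ → (s ≡ true → s′ ≡ true) →
            indicator (not s) + indicator (not s′) + (indicator s + indicator s) ≤ 2
    bound true  s′ s⇒s′ rewrite s⇒s′ refl = ≤-refl
    bound false true  _ = s≤s z≤n
    bound false false _ = ≤-refl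

  levels-degree≤ : ∀ g (y : Fin (suc q)) →
    degreeIn y (map (uncurry tip) (levels g)) + degreeIn y (map (spare ∘ proj₁) (levels g)) ≤ 2 * g
  levels-degree≤ zero    y = z≤n
  levels-degree≤ (suc g) y = begin
    (a + (b + D)) + (s + (s + S)) ≡⟨ solve 5 (λ a b s D S → (a :+ (b :+ D)) :+ (s :+ (s :+ S))
                                                  := (a :+ b :+ (s :+ s)) :+ (D :+ S)) refl a b s D S ⟩
    (a + b + (s + s)) + (D + S)   ≤⟨ +-mono-≤ (level-degree≤2 g y) (levels-degree≤ g y) ⟩
    2 + 2 * g                     ≡⟨ sym (*-suc 2 g) ⟩
    2 * suc g                     ∎
    where
    open ≤-Reasoning
    open +-*-Solver
    a = indicator (lookup (tip g false) y)
    b = indicator (lookup (tip g true) y)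
    s = indicator (lookup (spare g) y)
    D = degreeIn y (map (uncurry tip) (levels g))
    S = degreeIn y (map (spare ∘ proj₁) (levels g))

  -- The top block occupies the first suc q vertices; the blocks below follow it.
  order : ℕ → ℕ
  order zero    = 0
  order (suc k) = suc q + order k

  X : ∀ k → Subset (order k)
  X zero    = []
  X (suc k) = ⁅ fzero ⁆ ++ X k

  uncovered : ∀ k → ℕ → Subset (order k)
  uncovered zero    c = []
  uncovered (suc k) c = spare c ++ ⊥

  levelCount : ℕ → ℕ
  levelCount zero    = 1
  levelCount (suc k) = q

  edgesOf : ∀ k → List (Subset (order k))
  edgesOf zero    = []
  edgesOf (suc k) = layer (uncovered k) (levelCount k) (edgesOf k)

  levelCount≤q : ∀ k → levelCount k ≤ q
  levelCount≤q zero    = 0<q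
  levelCount≤q (suc k) = ≤-refl

  order≡ : ∀ k → order k ≡ (q + 1) * k
  order≡ zero    = sym (*-zeroʳ (q + 1))
  order≡ (suc k) = trans (cong₂ _+_ (+-comm 1 q) (order≡ k)) (sym (*-suc (q + 1) k))

  ∣X∣≡ : ∀ k → ∣ X k ∣ ≡ k
  ∣X∣≡ zero    = refl
  ∣X∣≡ (suc k) = cong suc (trans (∣⊥-++∣ {m = q} (X k)) (∣X∣≡ k))

  ∣uncovered∣≡ : ∀ k {c} → c < levelCount k → ∣ uncovered k c ∣ ≡ c
  ∣uncovered∣≡ zero    (s≤s z≤n) = refl
  ∣uncovered∣≡ (suc k) {c} c<q = trans (∣-++∣ (prefix c q) (⊥ {order k}))
    (trans (cong₂ _+_ (∣prefix∣ (<⇒≤ c<q)) (∣⊥∣≡0 (order k))) (+-identityʳ c))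

  uncovered-zero : ∀ k → uncovered k 0 ≡ ⊥
  uncovered-zero zero    = refl
  uncovered-zero (suc k) = ⊥-++ {suc q}

  uncovered⊆∁X : ∀ k {c} → uncovered k c ⊆ ∁ (X k)
  uncovered⊆∁X zero    ()
  uncovered⊆∁X (suc k) =
    ⊆-trans (++-mono-⊆ (out⊆ (⊆-trans ⊆⊤ (⊆-reflexive (sym (∁⊥≡⊤ {q}))))) ⊥⊆)
            (⊆-reflexive (sym (∁-++ ⁅ fzero ⁆ (X k))))

  uncovered-mono : ∀ k {c c′} → c ≤ c′ → uncovered k c ⊆ uncovered k c′
  uncovered-mono zero    _    ()
  uncovered-mono (suc k) c≤c′ = ++-mono-⊆ (s⊆s (prefix-mono q c≤c′)) ⊆-refl

  edgesOf-uniform : ∀ k → All (λ e → ∣ e ∣ ≡ q) (edgesOf k)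
  edgesOf-uniform zero    = []
  edgesOf-uniform (suc k) = layer-uniform (levelCount≤q k) (∣uncovered∣≡ k) (edgesOf-uniform k)

  edgesOf-unique : ∀ k → Unique (edgesOf k)
  edgesOf-unique zero    = []
  edgesOf-unique (suc k) = layer-unique (levelCount≤q k) (edgesOf-unique k)

  edgesOf-meet-X≤1 : ∀ k → All (λ e → ∣ e ∩ X k ∣ ≤ 1) (edgesOf k)
  edgesOf-meet-X≤1 zero    = []
  edgesOf-meet-X≤1 (suc k) = layer-meets-≤1 (X k) (λ c → uncovered⊆∁X k) (edgesOf-meet-X≤1 k)

  length-edgesOf≤ : ∀ k → length (edgesOf k) ≤ 2 * (q + 1) * k
  length-edgesOf≤ zero    = z≤n
  length-edgesOf≤ (suc k) = begin
    length (edgesOf (suc k))                ≡⟨ length-layer (uncovered k) (levelCount k) (edgesOf k) ⟩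
    2 * levelCount k + length (edgesOf k)   ≤⟨ +-mono-≤ (*-monoʳ-≤ 2 (≤-trans (levelCount≤q k) (m≤m+n q 1)))
                                                         (length-edgesOf≤ k) ⟩
    2 * (q + 1) + 2 * (q + 1) * k           ≡⟨ sym (*-suc (2 * (q + 1)) k) ⟩
    2 * (q + 1) * suc k                     ∎
    where open ≤-Reasoning

  nextLayerDegree : ∀ k → Fin (order k) → ℕ
  nextLayerDegree k z = degreeIn z (map (uncovered k ∘ proj₁) (levels (levelCount k)))

  degree+nextLayerDegree≤2q : ∀ k z → degreeIn z (edgesOf k) + nextLayerDegree k z ≤ 2 * q
  degree+nextLayerDegree≤2q zero    ()
  degree+nextLayerDegree≤2q (suc k) z with split (suc q) (order k) z
  ... | left y = begin
    degreeIn (y ↑ˡ order k) (edgesOf (suc k)) + nextLayerDegree (suc k) (y ↑ˡ order k)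
      ≡⟨ cong₂ _+_ (degreeIn-layer-new (uncovered k) (levelCount k) (edgesOf k) y)
                   (degreeIn-map-++ˡ (spare ∘ proj₁) (λ _ → ⊥) (levels q) y) ⟩
    degreeIn y (map (uncurry tip) (levels (levelCount k))) + degreeIn y (map (spare ∘ proj₁) (levels q))
      ≤⟨ +-monoˡ-≤ _ (degreeIn-map-levels-mono (uncurry tip) y (levelCount≤q k)) ⟩
    degreeIn y (map (uncurry tip) (levels q)) + degreeIn y (map (spare ∘ proj₁) (levels q))
      ≤⟨ levels-degree≤ q y ⟩
    2 * q ∎
    where open ≤-Reasoning
  ... | right z = begin
    degreeIn (suc q ↑ʳ z) (edgesOf (suc k)) + nextLayerDegree (suc k) (suc q ↑ʳ z)
      ≡⟨ cong₂ _+_ (degreeIn-layer-old (uncovered k) (levelCount k) (edgesOf k) z)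
                   (degreeIn-map-++ʳ (spare ∘ proj₁) (λ _ → ⊥) (levels q) z) ⟩
    (nextLayerDegree k z + degreeIn z (edgesOf k)) + degreeIn z (map (λ _ → ⊥) (levels q))
      ≡⟨ cong₂ _+_ (+-comm (nextLayerDegree k z) _) (degreeIn-map-⊥ (levels q) z) ⟩
    (degreeIn z (edgesOf k) + nextLayerDegree k z) + 0
      ≡⟨ +-identityʳ _ ⟩
    degreeIn z (edgesOf k) + nextLayerDegree k z
      ≤⟨ degree+nextLayerDegree≤2q k z ⟩
    2 * q ∎
    where open ≤-Reasoning

  block-restrict : (l : Bool) (r : Subset q) (L X′ : Subset m) (c : ℕ) →
                   (((l ∷ r) ++ L) ∪ ∁ (⁅ fzero ⁆ ++ X′)) ─ (spare c ++ ⊥) ≡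
                   (l ∷ ∁ (prefix c q)) ++ (L ∪ ∁ X′)
  block-restrict l r L X′ c = begin
    (((l ∷ r) ++ L) ∪ ∁ (⁅ fzero ⁆ ++ X′)) ─ (spare c ++ ⊥)
      ≡⟨ cong (λ p → (((l ∷ r) ++ L) ∪ p) ─ (spare c ++ ⊥)) (∁-++ ⁅ fzero ⁆ X′) ⟩
    (((l ∷ r) ++ L) ∪ (∁ ⁅ fzero ⁆ ++ ∁ X′)) ─ (spare c ++ ⊥)
      ≡⟨ cong (_─ (spare c ++ ⊥)) (∪-++ (l ∷ r) (∁ ⁅ fzero ⁆) L (∁ X′)) ⟩
    (((l ∷ r) ∪ ∁ ⁅ fzero ⁆) ++ (L ∪ ∁ X′)) ─ (spare c ++ ⊥)
      ≡⟨ ─-++ ((l ∷ r) ∪ ∁ ⁅ fzero ⁆) (spare c) (L ∪ ∁ X′) ⊥ ⟩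
    (((l ∷ r) ∪ ∁ ⁅ fzero ⁆) ─ spare c) ++ ((L ∪ ∁ X′) ─ ⊥)
      ≡⟨ cong₂ _++_ (cong₂ _∷_ (∨-identityʳ l) tail) (p─⊥≡p (L ∪ ∁ X′)) ⟩
    (l ∷ ∁ (prefix c q)) ++ (L ∪ ∁ X′) ∎
    where
    open ≡-Reasoning
    tail : (r ∪ ∁ ⊥) ─ prefix c q ≡ ∁ (prefix c q)
    tail = trans (cong (λ p → (r ∪ p) ─ prefix c q) ∁⊥≡⊤)
                 (trans (cong (_─ prefix c q) (∪-zeroʳ r)) (⊤─p≡∁p (prefix c q)))

  matchable : ∀ k (L : Subset (order k)) → L ⊆ X k →
              Σ ℕ λ c → c < levelCount k × PerfectMatching (edgesOf k) ((L ∪ ∁ (X k)) ─ uncovered k c)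
  matchable zero    []  _   = 0 , s≤s z≤n , [] , ([] , []) , refl
  matchable (suc k) L L⊆X with splitAt (suc q) L
  ... | l ∷ r , L′ , refl with matchable k L′ (⊆-++⁻ʳ (l ∷ r) ⁅ fzero ⁆ L⊆X)
  ... | c , c<g , pm with layer-step (uncovered-zero k) (levelCount≤q k) c<g
                            (⊆-trans (uncovered⊆∁X k) (q⊆p∪q L′ (∁ (X k)))) pm l
  ... | c′ , c′<q , pm′ =
    c′ , c′<q , subst (PerfectMatching (edgesOf (suc k))) (sym (block-restrict l r L′ (X k) c′)) pm′

  matching : ∀ k (L : Subset (order k)) → L ⊆ X k →
             Σ (List (Subset (order k))) λ M →
               IsMatchingIn (edgesOf k) M
               × ((L ∪ ∁ (X k)) ─ uncovered k (q ∸ 1)) ⊆ ⋃ M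
               × ⋃ M ⊆ (L ∪ ∁ (X k))
  matching k L L⊆X with matchable k L L⊆X
  ... | c , c<g , M , isMatching , ⋃M≡ =
    M , isMatching ,
    ⊆-trans (─-antimonoʳ-⊆ (L ∪ ∁ (X k)) (uncovered-mono k (<⇒≤pred (≤-trans c<g (levelCount≤q k)))))
            (⊆-reflexive (sym ⋃M≡)) ,
    ⊆-trans (⊆-reflexive ⋃M≡) (p─q⊆p (L ∪ ∁ (X k)) (uncovered k c))

  hypergraph : ℕ → Hypergraph q
  hypergraph k = record
    { nV = order k ; edges = edgesOf k ; uniform = edgesOf-uniform k ; distinct = edgesOf-unique k }

  maxDegree≤2q : ∀ k → MaxDegree≤ (hypergraph k) (2 * q)
  maxDegree≤2q k x = subst (_≤ 2 * q) (sym (length-filter-∈?≡degreeIn x (edgesOf k)))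
                           (≤-trans (m≤m+n _ _) (degree+nextLayerDegree≤2q k x))

  q∸1<levelCount : ∀ {n} → q ≡ 1 ⊎ 1 ≤ n → q ∸ 1 < levelCount n
  q∸1<levelCount {zero}  (inj₁ refl) = s≤s z≤n
  q∸1<levelCount {zero}  (inj₂ ())
  q∸1<levelCount {suc n} _           = ∸-monoʳ-< (s≤s z≤n) 0<q

proposition2p4 : (q : ℕ) → 1 ≤ q → (n : ℕ) → (q ≡ 1 ⊎ 1 ≤ n) →
  Σ (Hypergraph q) λ H →
  Σ (Subset (nV H)) λ X →
  Σ (Subset (nV H)) λ X' →
    ∣ X ∣ ≡ n
    × All (λ ed → ∣ ed ∩ X ∣ ≤ 1) (edges H)
    × v H ≡ (q + 1) * ∣ X ∣
    × MaxDegree≤ H (2 * q)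
    × e H ≤ 2 * (q + 1) * ∣ X ∣
    × X' ⊆ ∁ X
    × ∣ X' ∣ ≡ q ∸ 1
    × ((L : Subset (nV H)) → L ⊆ X →
        Σ (List (Subset (nV H))) λ M →
          IsMatching H M
          × ((L ∪ ∁ X) ─ X') ⊆ VM M
          × VM M ⊆ (L ∪ ∁ X))
proposition2p4 q 0<q n q≡1⊎1≤n =
  hypergraph n , X n , uncovered n (q ∸ 1) ,
  ∣X∣≡ n ,
  edgesOf-meet-X≤1 n ,
  subst (λ s → order n ≡ (q + 1) * s) (sym (∣X∣≡ n)) (order≡ n) ,
  maxDegree≤2q n ,
  subst (λ s → length (edgesOf n) ≤ 2 * (q + 1) * s) (sym (∣X∣≡ n)) (length-edgesOf≤ n) ,
  uncovered⊆∁X n ,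
  ∣uncovered∣≡ n (q∸1<levelCount q≡1⊎1≤n) ,
  matching n
  where open Construction q 0<q
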